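{- Let $K$ be a field of characteristic $0$, $a(z)=\sum_{i=0}^ua_iz^i$, $b(z)=\sum_{j=0}^vb_jz^j\in K[z]$ with $a(z)\ne0$, $\deg a=u$, $\deg b=v$, $D=-a(z)\partial_z+b(z)$, and $w=\max\{u-2,v-1\}$. Assume $w\ge0$ and that if $u-2=v-1$ then $a_u(k+u)+b_v\ne0$ for all integers $k\ge0$. Then there exist $f_0(z),\dots,f_w(z)\in(1/z)K[[1/z]]$, linearly independent over $K$, with $D\cdot f_l(z)\in K[z]$ for $0\le l\le w$.
   Context: $K[[1/z]]$ denotes formal power series in $1/z$ over $K$; $D$ acts by formal differentiation in $z$. -}

module Defs where

open import Level using (Level; _⊔_)
open import Data.Nat as ℕ using (ℕ; zero; suc)
open import Data.Fin as F using (Fin; toℕ; fromℕ)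
open import Data.Product using (∃)
open import Relation.Nullary using (¬_)
open import Algebra.Bundles using (CommutativeRing)
import Algebra.Definitions.RawMonoid as RawMonoidDefs

record Field (c ℓ : Level) : Set (Level.suc (c ⊔ ℓ)) where
  field
    commutativeRing : CommutativeRing c ℓ
  open CommutativeRing commutativeRing public
  field
    1≉0 : ¬ (1# ≈ 0#)
    inverse : ∀ x → ¬ (x ≈ 0#) → ∃ λ y → x * y ≈ 1#

module FieldDefs {c ℓ : Level} (K : Field c ℓ) where
  open Field K

  infix 8 _·_
  _·_ : ℕ → Carrier → Carrier
  _·_ = RawMonoidDefs._×_ +-rawMonoid

  CharZero : Set ℓ
  CharZero = ∀ (n : ℕ) → ¬ ((suc n · 1#) ≈ 0#)

  Σ : ∀ {n} → (Fin n → Carrier) → Carrier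
  Σ {zero} f = 0#
  Σ {suc n} f = f F.zero + Σ (λ i → f (F.suc i))

  -- A polynomial of degree u: coefficients p 0, …, p u with p u ≠ 0.
  -- (coefficient of z^i is p i)
  Poly : ℕ → Set c
  Poly u = Fin (suc u) → Carrier

  HasDegree : (u : ℕ) → Poly u → Set ℓ
  HasDegree u p = ¬ (p (fromℕ u) ≈ 0#)

  leading : (u : ℕ) → Poly u → Carrier
  leading u p = p (fromℕ u)

  -- An element of (1/z)K[[1/z]]:  f n = coefficient of z^{-(n+1)}.
  Series : Set c
  Series = ℕ → Carrier

  -- formal derivative in z: d/dz z^{-(n+1)} = -(n+1) z^{-(n+2)},
  -- so the coefficient of z^{-(k+1)} in f' is 0 for k = 0 and -(k·f(k-1)) otherwise.
  deriv : Series → Series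
  deriv f zero = 0#
  deriv f (suc n) = - (suc n · f n)

  -- coefficient of z^{-(m+1)} in p(z)·g(z) for p a polynomial of degree ≤ u
  -- and g ∈ (1/z)K[[1/z]]:  Σ_i p_i g_{m+i}
  polyMulNeg : ∀ {u} → Poly u → Series → ℕ → Carrier
  polyMulNeg {u} p g m = Σ (λ (i : Fin (suc u)) → p i * g (m ℕ.+ toℕ i))

  DNeg : ∀ {u v} → Poly u → Poly v → Series → ℕ → Carrier
  DNeg a b f m = - polyMulNeg a (deriv f) m + polyMulNeg b f m

  -- D·f ∈ K[z]  ⇔  all coefficients of negative powers of z vanish
  DInPoly : ∀ {u v} → Poly u → Poly v → Series → Set ℓ
  DInPoly a b f = ∀ m → DNeg a b f m ≈ 0#

  LinIndep : ∀ {n} → (Fin n → Series) → Set (c ⊔ ℓ)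
  LinIndep {n} f = ∀ (coef : Fin n → Carrier) →
    (∀ m → Σ (λ l → coef l * f l m) ≈ 0#) → ∀ l → coef l ≈ 0#

-- The coefficients of D·f at the negative powers z^{-(m+1)} form a linear
-- system in the coefficients f_k of f ∈ (1/z)K[[1/z]] which is triangular:
-- the m-th equation involves only f_0, …, f_{m+w+1}, and f_{m+w+1} enters
-- with coefficient a_u·(m+u) + b_v (reading a_u = 0 unless u = w+2 and
-- b_v = 0 unless v = w+1), which is nonzero by characteristic 0 and the
-- hypothesis on a_u, b_v.  Hence f_0, …, f_w can be prescribed freely and
-- the remaining coefficients solved for one at a time; prescribing the unit
-- vectors gives w+1 solutions that are independent already on f_0, …, f_w.
module Submission where

open import Defs
open import Level using (Level)
open import Data.Nat as ℕ using (ℕ; suc; _∸_; _≤_)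
open import Data.Fin using (Fin)
open import Data.Sum using (_⊎_)
open import Data.Product using (Σ-syntax; _×_)
open import Relation.Nullary using (¬_)
open import Relation.Binary.PropositionalEquality using (_≡_)

open import Data.Nat using (zero; _<_; _≟_; _≤?_; _⊔_; _≤′_; ≤′-refl; ≤′-step; s≤s)
import Data.Nat.Properties as ℕₚ
open import Data.Fin using (toℕ; fromℕ; punchIn)
open import Data.Fin.Properties using (toℕ-injective; toℕ-fromℕ; toℕ≤pred[n]; toℕ<n; punchInᵢ≢i)
open import Data.Vec.Functional using (removeAt; replicate)
open import Data.Sum using (inj₁; inj₂; [_,_])
import Data.Sum as Sum
open import Data.Product using (_,_; proj₁; proj₂)
open import Data.Empty using (⊥-elim)
open import Function using (_∘_)
open import Relation.Nullary using (Dec; yes; no)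
open import Relation.Binary.PropositionalEquality using (_≢_; cong)
import Relation.Binary.PropositionalEquality as ≡

∸≡⇒≡+ : ∀ {m n o} → n ≤ m → m ∸ n ≡ o → m ≡ n ℕ.+ o
∸≡⇒≡+ n≤m e = ≡.trans (≡.sym (ℕₚ.m+[n∸m]≡n n≤m)) (cong (_ ℕ.+_) e)

max-attained : ∀ {u v p q} → p ≤ u ⊎ q ≤ v →
  u ≡ p ℕ.+ ((u ∸ p) ⊔ (v ∸ q)) ⊎ v ≡ q ℕ.+ ((u ∸ p) ⊔ (v ∸ q))
max-attained {u} {v} {p} {q} p≤u⊎q≤v with p ≤? u | q ≤? v
... | yes p≤u | yes q≤v =
  Sum.map (∸≡⇒≡+ p≤u ∘ ≡.sym) (∸≡⇒≡+ q≤v ∘ ≡.sym) (ℕₚ.⊔-sel (u ∸ p) (v ∸ q))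
... | yes p≤u | no q≰v =
  inj₁ (∸≡⇒≡+ p≤u (≡.sym (≡.trans (cong ((u ∸ p) ⊔_) v∸q≡0) (ℕₚ.⊔-identityʳ (u ∸ p)))))
  where
  v∸q≡0 : v ∸ q ≡ 0
  v∸q≡0 = ℕₚ.m≤n⇒m∸n≡0 (ℕₚ.<⇒≤ (ℕₚ.≰⇒> q≰v))
... | no p≰u | yes q≤v = inj₂ (∸≡⇒≡+ q≤v (≡.sym (cong (_⊔ (v ∸ q)) u∸p≡0)))
  where
  u∸p≡0 : u ∸ p ≡ 0
  u∸p≡0 = ℕₚ.m≤n⇒m∸n≡0 (ℕₚ.<⇒≤ (ℕₚ.≰⇒> p≰u))
... | no p≰u | no q≰v = ⊥-elim ([ p≰u , q≰v ] p≤u⊎q≤v)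

module FormalSeries {c ℓ : Level} (K : Field c ℓ) where
  open Field K hiding (zero)
  open FieldDefs K
  open import Algebra.Properties.Ring ring using (-‿distribˡ-*; -‿distribʳ-*; -‿+-comm; -‿involutive; -0#≈0#)
  open import Algebra.Properties.Semiring.Sum semiring
    using (sum; sum-cong-≋; sum-remove; sum-replicate-zero; ∑-distrib-+; *-distribˡ-sum; *-distribʳ-sum)
  open import Algebra.Properties.Semiring.Mult semiring using (×-comm-*; ×-congʳ)
  open import Algebra.Properties.CommutativeMonoid.Mult +-commutativeMonoid using (×-distrib-+)
  open import Algebra.Properties.CommutativeSemigroup *-commutativeSemigroup using (x∙yz≈y∙xz; xy∙z≈y∙xz)
  open import Algebra.Properties.CommutativeSemigroup +-commutativeSemigroup using (interchange)
  open import Relation.Binary.Reasoning.Setoid setoid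

  ≉0-resp-≈ : ∀ {x y} → x ≈ y → ¬ y ≈ 0# → ¬ x ≈ 0#
  ≉0-resp-≈ x≈y y≉0 x≈0 = y≉0 (trans (sym x≈y) x≈0)

  *-≉0 : ∀ {x y} → ¬ x ≈ 0# → ¬ y ≈ 0# → ¬ x * y ≈ 0#
  *-≉0 {x} {y} x≉0 y≉0 xy≈0 = y≉0 (begin
    y              ≈⟨ sym (*-identityˡ y) ⟩
    1# * y         ≈⟨ *-congʳ (sym (proj₂ (inverse x x≉0))) ⟩
    (x * x⁻¹) * y  ≈⟨ xy∙z≈y∙xz x x⁻¹ y ⟩
    x⁻¹ * (x * y)  ≈⟨ *-congˡ xy≈0 ⟩
    x⁻¹ * 0#       ≈⟨ zeroʳ x⁻¹ ⟩
    0#             ∎)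
    where
    x⁻¹ : Carrier
    x⁻¹ = proj₁ (inverse x x≉0)

  x+-[x*y]*z≈0 : ∀ x y z → z * y ≈ 1# → x + - (x * y) * z ≈ 0#
  x+-[x*y]*z≈0 x y z zy≈1 = begin
    x + - (x * y) * z    ≈⟨ +-congˡ (sym (-‿distribˡ-* (x * y) z)) ⟩
    x + - (x * y * z)    ≈⟨ +-congˡ (-‿cong (*-assoc x y z)) ⟩
    x + - (x * (y * z))  ≈⟨ +-congˡ (-‿cong (*-congˡ (trans (*-comm y z) zy≈1))) ⟩
    x + - (x * 1#)       ≈⟨ +-congˡ (-‿cong (*-identityʳ x)) ⟩
    x + - x              ≈⟨ -‿inverseʳ x ⟩
    0#                   ∎

  -‿[x*-y]≈x*y : ∀ x y → - (x * - y) ≈ x * y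
  -‿[x*-y]≈x*y x y = trans (-‿cong (sym (-‿distribʳ-* x y))) (-‿involutive (x * y))

  ×-zeroʳ : ∀ n → n · 0# ≈ 0#
  ×-zeroʳ n = begin
    n · 0#          ≈⟨ ×-congʳ n (sym (zeroˡ 0#)) ⟩
    n · (0# * 0#)   ≈⟨ sym (×-comm-* n 0# 0#) ⟩
    0# * (n · 0#)   ≈⟨ zeroˡ _ ⟩
    0#              ∎

  Σ≈sum : ∀ {n} (f : Fin n → Carrier) → Σ f ≈ sum f
  Σ≈sum {zero} f = refl
  Σ≈sum {suc n} f = +-congˡ (Σ≈sum (λ i → f (Data.Fin.suc i)))

  Σ-cong : ∀ {n} (f g : Fin n → Carrier) → (∀ i → f i ≈ g i) → Σ f ≈ Σ g
  Σ-cong f g f≈g = trans (Σ≈sum f) (trans (sum-cong-≋ f≈g) (sym (Σ≈sum g)))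

  Σ-zero : ∀ {n} (f : Fin n → Carrier) → (∀ i → f i ≈ 0#) → Σ f ≈ 0#
  Σ-zero {n} f f≈0 = trans (Σ≈sum f) (trans (sum-cong-≋ f≈0) (sum-replicate-zero n))

  Σ-+ : ∀ {n} (f g : Fin n → Carrier) → Σ (λ i → f i + g i) ≈ Σ f + Σ g
  Σ-+ f g = trans (Σ≈sum (λ i → f i + g i)) (trans (∑-distrib-+ f g) (sym (+-cong (Σ≈sum f) (Σ≈sum g))))

  *-distribˡ-Σ : ∀ {n} x (f : Fin n → Carrier) → x * Σ f ≈ Σ (λ i → x * f i)
  *-distribˡ-Σ x f = trans (*-congˡ (Σ≈sum f)) (trans (*-distribˡ-sum x f) (sym (Σ≈sum (λ i → x * f i))))

  *-distribʳ-Σ : ∀ {n} x (f : Fin n → Carrier) → Σ f * x ≈ Σ (λ i → f i * x)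
  *-distribʳ-Σ x f = trans (*-congʳ (Σ≈sum f)) (trans (*-distribʳ-sum x f) (sym (Σ≈sum (λ i → f i * x))))

  Σ-single : ∀ {n} (f : Fin (suc n) → Carrier) i → (∀ j → j ≢ i → f j ≈ 0#) → Σ f ≈ f i
  Σ-single {n} f i off = begin
    Σ f                         ≈⟨ Σ≈sum f ⟩
    sum f                       ≈⟨ sum-remove {i = i} f ⟩
    f i + sum (removeAt f i)    ≈⟨ +-congˡ (sum-cong-≋ (λ j → off (punchIn i j) (punchInᵢ≢i i j))) ⟩
    f i + sum (replicate n 0#)  ≈⟨ +-congˡ (sum-replicate-zero n) ⟩
    f i + 0#                    ≈⟨ +-identityʳ (f i) ⟩
    f i                         ∎

  opaque
    δ : ℕ → Series
    δ N k with k ≟ N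
    ... | yes _ = 1#
    ... | no _ = 0#

    δ-diag : ∀ N → δ N N ≡ 1#
    δ-diag N with N ≟ N
    ... | yes _ = ≡.refl
    ... | no N≢N = ⊥-elim (N≢N ≡.refl)

    δ-offDiag : ∀ {N k} → k ≢ N → δ N k ≡ 0#
    δ-offDiag {N} {k} k≢N with k ≟ N
    ... | yes k≡N = ⊥-elim (k≢N k≡N)
    ... | no _ = ≡.refl

  *-δ-offDiag : ∀ x {N k} → k ≢ N → x * δ N k ≈ 0#
  *-δ-offDiag x k≢N = trans (*-congˡ (reflexive (δ-offDiag k≢N))) (zeroʳ x)

  addScaled : Series → Carrier → Series → Series
  addScaled g d h k = g k + d * h k

  addScaled-δ-offDiag : ∀ g d {N k} → k ≢ N → addScaled g d (δ N) k ≈ g k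
  addScaled-δ-offDiag g d k≢N = trans (+-congˡ (*-δ-offDiag d k≢N)) (+-identityʳ _)

  unitPrefix⇒LinIndep : ∀ {n} (f : Fin n → Series) →
    (∀ l k → k < n → f l k ≈ δ (toℕ l) k) → LinIndep f
  unitPrefix⇒LinIndep {suc n} f unit coef vanish l = begin
    coef l                          ≈⟨ sym (*-identityʳ (coef l)) ⟩
    coef l * 1#                     ≈⟨ *-congˡ (sym (trans (unit l (toℕ l) (toℕ<n l)) (reflexive (δ-diag (toℕ l))))) ⟩
    coef l * f l (toℕ l)            ≈⟨ sym (Σ-single _ l off) ⟩
    Σ (λ j → coef j * f j (toℕ l))  ≈⟨ vanish (toℕ l) ⟩
    0#                              ∎
    where
    off : ∀ j → j ≢ l → coef j * f j (toℕ l) ≈ 0#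
    off j j≢l = trans (*-congˡ (unit j (toℕ l) (toℕ<n l)))
                      (*-δ-offDiag (coef j) (j≢l ∘ ≡.sym ∘ toℕ-injective))

  -- Equation m is solved for the value at m + s; approx init m satisfies
  -- equations 0, …, m-1 and is already final below m + s.
  module TriangularSystem (s : ℕ) (E : Series → ℕ → Carrier)
    (E-local : ∀ {g h} m → (∀ k → k ≤ m ℕ.+ s → g k ≈ h k) → E g m ≈ E h m)
    (E-addScaled : ∀ g d h m → E (addScaled g d h) m ≈ addScaled (E g) d (E h) m)
    (E-pivot : ∀ m → ¬ E (δ (m ℕ.+ s)) m ≈ 0#) where

    approx : Series → ℕ → Series
    approx init zero = init
    approx init (suc m) = addScaled (approx init m) (- (E (approx init m) m * pivot⁻¹)) (δ (m ℕ.+ s))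
      where
      pivot⁻¹ : Carrier
      pivot⁻¹ = proj₁ (inverse _ (E-pivot m))

    approx-solves : ∀ init m → E (approx init (suc m)) m ≈ 0#
    approx-solves init m =
      trans (E-addScaled _ _ _ m) (x+-[x*y]*z≈0 _ _ _ (proj₂ (inverse _ (E-pivot m))))

    approx-stable : ∀ init {m n k} → m ≤′ n → k < m ℕ.+ s → approx init n k ≈ approx init m k
    approx-stable init ≤′-refl _ = refl
    approx-stable init {_} {suc n} {k} (≤′-step m≤n) k<m+s =
      trans (addScaled-δ-offDiag (approx init n) _ {n ℕ.+ s} k≢n+s) (approx-stable init m≤n k<m+s)
      where
      k≢n+s : k ≢ n ℕ.+ s
      k≢n+s = ℕₚ.<⇒≢ (ℕₚ.<-≤-trans k<m+s (ℕₚ.+-monoˡ-≤ s (ℕₚ.≤′⇒≤ m≤n)))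

    solution : Series → Series
    solution init k = approx init (suc k) k

    solution-approx : ∀ init {m k} → k < m ℕ.+ s → solution init k ≈ approx init m k
    solution-approx init {m} {k} k<m+s with ℕₚ.≤-total m (suc k)
    ... | inj₁ m≤1+k = approx-stable init (ℕₚ.≤⇒≤′ m≤1+k) k<m+s
    ... | inj₂ 1+k≤m = sym (approx-stable init (ℕₚ.≤⇒≤′ 1+k≤m) (s≤s (ℕₚ.m≤m+n k s)))

    solution-init : ∀ init {k} → k < s → solution init k ≈ init k
    solution-init init = solution-approx init

    solution-solves : ∀ init m → E (solution init) m ≈ 0#
    solution-solves init m =
      trans (E-local m (λ k k≤m+s → solution-approx init (s≤s k≤m+s))) (approx-solves init m)

  deriv-local : ∀ {g h : Series} n → (∀ k → k ≤ n → g k ≈ h k) → ∀ k → k ≤ suc n → deriv g k ≈ deriv h k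
  deriv-local n agree zero _ = refl
  deriv-local n agree (suc k) (s≤s k≤n) = -‿cong (×-congʳ (suc k) (agree k k≤n))

  deriv-addScaled : ∀ g d h k → deriv (addScaled g d h) k ≈ addScaled (deriv g) d (deriv h) k
  deriv-addScaled g d h zero = sym (trans (+-identityˡ _) (zeroʳ d))
  deriv-addScaled g d h (suc k) = begin
    - (suc k · (g k + d * h k))               ≈⟨ -‿cong (×-distrib-+ (g k) (d * h k) (suc k)) ⟩
    - (suc k · g k + suc k · (d * h k))       ≈⟨ sym (-‿+-comm _ _) ⟩
    - (suc k · g k) + - (suc k · (d * h k))   ≈⟨ +-congˡ (-‿cong (sym (×-comm-* (suc k) d (h k)))) ⟩
    - (suc k · g k) + - (d * suc k · h k)     ≈⟨ +-congˡ (-‿distribʳ-* d _) ⟩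
    - (suc k · g k) + d * - (suc k · h k)     ∎

  deriv-δ : ∀ N k → deriv (δ N) k ≈ δ (suc N) k * - (suc N · 1#)
  deriv-δ N zero = sym (trans (*-congʳ (reflexive (δ-offDiag {suc N} {zero} (λ ())))) (zeroˡ _))
  deriv-δ N (suc k) = by-cases (k ≟ N)
    where
    by-cases : Dec (k ≡ N) → deriv (δ N) (suc k) ≈ δ (suc N) (suc k) * - (suc N · 1#)
    by-cases (yes ≡.refl) = begin
      - (suc k · δ k k)                   ≈⟨ -‿cong (×-congʳ (suc k) (reflexive (δ-diag k))) ⟩
      - (suc k · 1#)                      ≈⟨ sym (*-identityˡ _) ⟩
      1# * - (suc k · 1#)                 ≈⟨ *-congʳ (reflexive (≡.sym (δ-diag (suc k)))) ⟩
      δ (suc k) (suc k) * - (suc k · 1#)  ∎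
    by-cases (no k≢N) = begin
      - (suc k · δ N k)                   ≈⟨ -‿cong (×-congʳ (suc k) (reflexive (δ-offDiag k≢N))) ⟩
      - (suc k · 0#)                      ≈⟨ -‿cong (×-zeroʳ (suc k)) ⟩
      - 0#                                ≈⟨ -0#≈0# ⟩
      0#                                  ≈⟨ sym (zeroˡ _) ⟩
      0# * - (suc N · 1#)                 ≈⟨ *-congʳ (reflexive (≡.sym (δ-offDiag (k≢N ∘ ℕₚ.suc-injective)))) ⟩
      δ (suc N) (suc k) * - (suc N · 1#)  ∎

  term : ∀ {u} → Poly u → Series → ℕ → Fin (suc u) → Carrier
  term p g m i = p i * g (m ℕ.+ toℕ i)

  polyMulNeg-local : ∀ {u} (p : Poly u) (g h : Series) m →
    (∀ k → k ≤ m ℕ.+ u → g k ≈ h k) → polyMulNeg p g m ≈ polyMulNeg p h m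
  polyMulNeg-local p g h m agree = Σ-cong (term p g m) (term p h m)
    (λ i → *-congˡ (agree (m ℕ.+ toℕ i) (ℕₚ.+-monoʳ-≤ m (toℕ≤pred[n] i))))

  polyMulNeg-addScaled : ∀ {u} (p : Poly u) g d h m →
    polyMulNeg p (addScaled g d h) m ≈ addScaled (polyMulNeg p g) d (polyMulNeg p h) m
  polyMulNeg-addScaled p g d h m = begin
    Σ (term p (addScaled g d h) m)
      ≈⟨ Σ-cong _ (λ i → term p g m i + d * term p h m i)
                (λ i → trans (distribˡ (p i) _ _) (+-congˡ (x∙yz≈y∙xz (p i) d _))) ⟩
    Σ (λ i → term p g m i + d * term p h m i)           ≈⟨ Σ-+ (term p g m) (λ i → d * term p h m i) ⟩
    Σ (term p g m) + Σ (λ i → d * term p h m i)         ≈⟨ +-congˡ (sym (*-distribˡ-Σ d (term p h m))) ⟩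
    Σ (term p g m) + d * Σ (term p h m)                 ∎

  polyMulNeg-*ʳ : ∀ {u} (p : Poly u) g d m → polyMulNeg p (λ k → g k * d) m ≈ polyMulNeg p g m * d
  polyMulNeg-*ʳ p g d m = begin
    Σ (term p (λ k → g k * d) m)   ≈⟨ Σ-cong _ (λ i → term p g m i * d) (λ i → sym (*-assoc (p i) _ d)) ⟩
    Σ (λ i → term p g m i * d)     ≈⟨ sym (*-distribʳ-Σ d (term p g m)) ⟩
    Σ (term p g m) * d             ∎

  polyMulNeg-δ-leading : ∀ {u} (p : Poly u) m {N} → m ℕ.+ u ≡ N → polyMulNeg p (δ N) m ≈ leading u p
  polyMulNeg-δ-leading {u} p m ≡.refl = begin
    Σ (term p (δ N) m)                 ≈⟨ Σ-single (term p (δ N) m) (fromℕ u) off ⟩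
    p (fromℕ u) * δ N (m ℕ.+ toℕ (fromℕ u))
      ≈⟨ *-congˡ (reflexive (≡.trans (cong (δ N ∘ (m ℕ.+_)) (toℕ-fromℕ u)) (δ-diag N))) ⟩
    p (fromℕ u) * 1#                   ≈⟨ *-identityʳ _ ⟩
    leading u p                        ∎
    where
    N : ℕ
    N = m ℕ.+ u

    off : ∀ i → i ≢ fromℕ u → p i * δ N (m ℕ.+ toℕ i) ≈ 0#
    off i i≢u = *-δ-offDiag (p i) (λ e → i≢u (toℕ-injective
                  (≡.trans (ℕₚ.+-cancelˡ-≡ m _ _ e) (≡.sym (toℕ-fromℕ u)))))

  polyMulNeg-δ-beyond : ∀ {u} (p : Poly u) m {N} → m ℕ.+ u < N → polyMulNeg p (δ N) m ≈ 0#
  polyMulNeg-δ-beyond p m {N} m+u<N = Σ-zero (term p (δ N) m) (λ i →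
    *-δ-offDiag (p i) (ℕₚ.<⇒≢ (ℕₚ.≤-<-trans (ℕₚ.+-monoʳ-≤ m (toℕ≤pred[n] i)) m+u<N)))

  module _ {u v : ℕ} (a : Poly u) (b : Poly v) where

    DNeg-local : ∀ {s} → u ≤ suc s → v ≤ s →
      ∀ {g h} m → (∀ k → k ≤ m ℕ.+ s → g k ≈ h k) → DNeg a b g m ≈ DNeg a b h m
    DNeg-local {s} u≤1+s v≤s {g} {h} m agree =
      +-cong (-‿cong (polyMulNeg-local a (deriv g) (deriv h) m
                       (λ k k≤m+u → deriv-local _ agree k (ℕₚ.≤-trans k≤m+u m+u≤1+m+s))))
             (polyMulNeg-local b g h m (λ k k≤m+v → agree k (ℕₚ.≤-trans k≤m+v (ℕₚ.+-monoʳ-≤ m v≤s))))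
      where
      m+u≤1+m+s : m ℕ.+ u ≤ suc (m ℕ.+ s)
      m+u≤1+m+s = ℕₚ.≤-trans (ℕₚ.+-monoʳ-≤ m u≤1+s) (ℕₚ.≤-reflexive (ℕₚ.+-suc m s))

    DNeg-addScaled : ∀ g d h m → DNeg a b (addScaled g d h) m ≈ addScaled (DNeg a b g) d (DNeg a b h) m
    DNeg-addScaled g d h m = begin
      - polyMulNeg a (deriv (addScaled g d h)) m + polyMulNeg b (addScaled g d h) m
        ≈⟨ +-cong (-‿cong (trans (polyMulNeg-local a _ (addScaled (deriv g) d (deriv h)) m
                                                     (λ k _ → deriv-addScaled g d h k))
                                 (polyMulNeg-addScaled a (deriv g) d (deriv h) m)))
                  (polyMulNeg-addScaled b g d h m) ⟩
      - (A g + d * A h) + (B g + d * B h)       ≈⟨ +-congʳ (sym (-‿+-comm _ _)) ⟩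
      (- A g + - (d * A h)) + (B g + d * B h)   ≈⟨ interchange _ _ _ _ ⟩
      (- A g + B g) + (- (d * A h) + d * B h)   ≈⟨ +-congˡ (+-congʳ (-‿distribʳ-* d _)) ⟩
      (- A g + B g) + (d * - A h + d * B h)     ≈⟨ +-congˡ (sym (distribˡ d _ _)) ⟩
      (- A g + B g) + d * (- A h + B h)         ∎
      where
      A B : Series → Carrier
      A f = polyMulNeg a (deriv f) m
      B f = polyMulNeg b f m

    DNeg-δ : ∀ N m → DNeg a b (δ N) m ≈ polyMulNeg a (δ (suc N)) m * (suc N · 1#) + polyMulNeg b (δ N) m
    DNeg-δ N m = +-congʳ (begin
      - polyMulNeg a (deriv (δ N)) m                 ≈⟨ -‿cong (polyMulNeg-local a _ (λ k → δ (suc N) k * κ) m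
                                                                                  (λ k _ → deriv-δ N k)) ⟩
      - polyMulNeg a (λ k → δ (suc N) k * κ) m       ≈⟨ -‿cong (polyMulNeg-*ʳ a (δ (suc N)) κ m) ⟩
      - (polyMulNeg a (δ (suc N)) m * - (suc N · 1#)) ≈⟨ -‿[x*-y]≈x*y _ _ ⟩
      polyMulNeg a (δ (suc N)) m * (suc N · 1#)      ∎)
      where
      κ : Carrier
      κ = - (suc N · 1#)

    -- The pivot of equation m sits at z^{-(m+s+1)}; only the top coefficients
    -- a_u (through -a f', when u = s+1) and b_v (when v = s) reach it.
    DNeg-δ-pivot : CharZero → HasDegree u a → HasDegree v b → ∀ {s} → u ≤ suc s → v ≤ s →
      (u ≡ suc s ⊎ v ≡ s) →
      (u ℕ.+ 1 ≡ v ℕ.+ 2 → ∀ k → ¬ (leading u a * ((k ℕ.+ u) · 1#) + leading v b ≈ 0#)) →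
      ∀ m → ¬ DNeg a b (δ (m ℕ.+ s)) m ≈ 0#
    DNeg-δ-pivot char a≢0 b≢0 {s} u≤1+s v≤s top resonance m = by-cases (u ≟ suc s) (v ≟ s)
      where
      N : ℕ
      N = m ℕ.+ s

      m+u≡1+N : u ≡ suc s → m ℕ.+ u ≡ suc N
      m+u≡1+N u≡1+s = ≡.trans (cong (m ℕ.+_) u≡1+s) (ℕₚ.+-suc m s)

      a-leading : u ≡ suc s → polyMulNeg a (δ (suc N)) m ≈ leading u a
      a-leading u≡1+s = polyMulNeg-δ-leading a m (m+u≡1+N u≡1+s)

      a-beyond : u ≢ suc s → polyMulNeg a (δ (suc N)) m ≈ 0#
      a-beyond u≢1+s = polyMulNeg-δ-beyond a m (ℕₚ.<-≤-trans (ℕₚ.+-monoʳ-< m (ℕₚ.≤∧≢⇒< u≤1+s u≢1+s))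
                                                             (ℕₚ.≤-reflexive (ℕₚ.+-suc m s)))

      b-leading : v ≡ s → polyMulNeg b (δ N) m ≈ leading v b
      b-leading v≡s = polyMulNeg-δ-leading b m (cong (m ℕ.+_) v≡s)

      b-beyond : v ≢ s → polyMulNeg b (δ N) m ≈ 0#
      b-beyond v≢s = polyMulNeg-δ-beyond b m (ℕₚ.+-monoʳ-< m (ℕₚ.≤∧≢⇒< v≤s v≢s))

      by-cases : Dec (u ≡ suc s) → Dec (v ≡ s) → ¬ DNeg a b (δ N) m ≈ 0#
      by-cases (yes u≡1+s) (yes v≡s) = ≉0-resp-≈
          (trans (DNeg-δ N m) (+-cong (*-cong (a-leading u≡1+s) (reflexive (cong (_· 1#) (≡.sym (m+u≡1+N u≡1+s)))))
                                      (b-leading v≡s)))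
          (resonance (≡.trans (cong (ℕ._+ 1) u≡1+s) (≡.sym (≡.trans (cong (ℕ._+ 2) v≡s) (ℕₚ.+-suc s 1)))) m)
      by-cases (yes u≡1+s) (no v≢s) = ≉0-resp-≈
          (trans (DNeg-δ N m) (trans (+-cong (*-congʳ (a-leading u≡1+s)) (b-beyond v≢s)) (+-identityʳ _)))
          (*-≉0 a≢0 (char N))
      by-cases (no u≢1+s) (yes v≡s) = ≉0-resp-≈
          (trans (DNeg-δ N m) (trans (+-cong (trans (*-congʳ (a-beyond u≢1+s)) (zeroˡ _)) (b-leading v≡s))
                                     (+-identityˡ _)))
          b≢0
      by-cases (no u≢1+s) (no v≢s) = ⊥-elim ([ u≢1+s , v≢s ] top)

lemma4p1 : ∀ {c ℓ : Level} (K : Field c ℓ) → 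
  let open Field K
      open FieldDefs K
  in
  CharZero →
  (u v : ℕ) (a : Poly u) (b : Poly v) →
  HasDegree u a → HasDegree v b →
  (2 ≤ u ⊎ 1 ≤ v) →
  (u ℕ.+ 1 ≡ v ℕ.+ 2 → ∀ (k : ℕ) → ¬ (leading u a * ((k ℕ.+ u) · 1#) + leading v b ≈ 0#)) →
  Σ[ f ∈ (Fin (suc ((u ∸ 2) ℕ.⊔ (v ∸ 1))) → Series) ]
    (LinIndep f × (∀ l → DInPoly a b (f l)))
lemma4p1 K char u v a b a≢0 b≢0 nondegenerate resonance =
  f , unitPrefix⇒LinIndep f (λ l k k<1+w → solution-init (δ (toℕ l)) k<1+w) ,
  λ l → solution-solves (δ (toℕ l))
  where
  open FieldDefs K using (Series; DNeg)
  open FormalSeries K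
  w : ℕ
  w = (u ∸ 2) ⊔ (v ∸ 1)

  u≤2+w : u ≤ 2 ℕ.+ w
  u≤2+w = ℕₚ.≤-trans (ℕₚ.m≤n+m∸n u 2) (ℕₚ.+-monoʳ-≤ 2 (ℕₚ.m≤m⊔n (u ∸ 2) (v ∸ 1)))

  v≤1+w : v ≤ 1 ℕ.+ w
  v≤1+w = ℕₚ.≤-trans (ℕₚ.m≤n+m∸n v 1) (ℕₚ.+-monoʳ-≤ 1 (ℕₚ.m≤n⊔m (u ∸ 2) (v ∸ 1)))

  open TriangularSystem (suc w) (DNeg a b) (DNeg-local a b u≤2+w v≤1+w) (DNeg-addScaled a b)
    (DNeg-δ-pivot a b char a≢0 b≢0 u≤2+w v≤1+w (max-attained nondegenerate) resonance)

  f : Fin (suc w) → Series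
  f l = solution (δ (toℕ l))
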